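{- For every integer $n\ge 0$, $$n!\sum_{F\in\mathcal{F}(n)}\prod_{v\in V(F)}\frac{1}{h_v}=(2n-1)!!,$$ and $$\sum_{F\in\mathcal{F}(n)}\prod_{v\in V(F)}\left(2-\frac{1}{h_v}\right)=\frac{(2n+1)^{n-1}}{n!}.$$
   Context: A plane tree is a rooted tree with unlabelled vertices in which the children of each vertex are linearly ordered. A plane forest is a linearly ordered sequence of plane trees; $\mathcal{F}(n)$ is the set of plane forests with $n$ vertices in total. $V(F)$ is the vertex set of $F$, and for $v\in V(F)$ the hook length $h_v$ is the number of vertices in the subtree rooted at $v$ (including $v$). $(2n-1)!!=1\cdot3\cdots(2n-1)$ (equal to $1$ when $n=0$); empty products equal $1$. -}

module Defs where

open import Data.Nat using (ℕ; zero; suc; _+_; _*_; _!)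
open import Data.Nat.Properties using (_!≢0)
open import Data.List using (List; []; _∷_; map; foldr; _++_; concatMap)
open import Data.Integer using (ℤ; +_)
open import Data.Rational using (ℚ; _/_; 0ℚ; 1ℚ) renaming (_+_ to _+ℚ_; _*_ to _*ℚ_; _-_ to _-ℚ_)

data PlaneTree : Set where
  node : List PlaneTree → PlaneTree

PlaneForest : Set
PlaneForest = List PlaneTree

mutual
  treeSize : PlaneTree → ℕ
  treeSize (node ts) = suc (forestSize ts)

  forestSize : PlaneForest → ℕ
  forestSize []       = 0
  forestSize (t ∷ ts) = treeSize t + forestSize ts

mutual
  treeHooks : PlaneTree → List ℕ
  treeHooks (node ts) = suc (forestSize ts) ∷ forestHooks ts

  forestHooks : PlaneForest → List ℕ
  forestHooks []       = []
  forestHooks (t ∷ ts) = treeHooks t ++ forestHooks ts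

-- 1/h for h ≥ 1 (hook lengths are always ≥ 1; the value at 0 is never used)
inv : ℕ → ℚ
inv zero    = 0ℚ
inv (suc k) = + 1 / suc k

sumℚ : List ℚ → ℚ
sumℚ = foldr _+ℚ_ 0ℚ

prodℚ : List ℚ → ℚ
prodℚ = foldr _*ℚ_ 1ℚ

oddDoubleFact : ℕ → ℕ
oddDoubleFact zero    = 1
oddDoubleFact (suc n) = (2 * n + 1) * oddDoubleFact n

divFact : ℤ → ℕ → ℚ
divFact z n = z / (n !)
  where instance _ = n !≢0

module Submission where

-- Splitting off the first tree, a forest of size n + 1 is a root of hook length k + 1 over a
-- forest of size k, followed by a forest of size n − k.  Hence S(n) = Σ_F Π_v w(h_v) satisfies
-- S(0) = 1 and S(n + 1) = Σ_k w(k + 1) S(k) S(n − k).  For w(h) = 1/h and w(h) = 2 − 1/h the claimed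
-- values are f_n(1) for the families f_n(x) = x(x+2)⋯(x+2n−2)/n! and f_n(x) = x(x+2n)^(n−1)/n!.
-- Both are of binomial type, Σ_k f_k(x) f_(n−k)(y) = f_n(x + y) (Vandermonde and Abel), which is
-- proved by comparing derivatives of generating functions.  Since f_(k+1)(−1) = −w(k + 1) f_k(1)
-- and f_(n+1)(0) = 0, this identity at x = −1, y = 1 is exactly the recurrence for S.

open import Defs
open import Data.Nat using (ℕ)
open import Data.Rational using (ℚ)

module Arithmetic where
  open import Level using (0ℓ)
  open import Data.Nat as ℕ using (ℕ; zero; suc; _!)
  import Data.Nat.Properties as ℕ
  open import Data.Integer as ℤ using (+_)
  import Data.Integer.Properties as ℤ
  open import Data.Rational
  open import Data.Rational.Properties
  import Data.Rational.Unnormalised as ℚᵘ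
  import Data.Rational.Unnormalised.Properties as ℚᵘ
  open import Relation.Nullary.Decidable using (dec⇒maybe)
  open import Relation.Binary.PropositionalEquality
  open import Tactic.RingSolver.Core.AlmostCommutativeRing using (AlmostCommutativeRing; fromCommutativeRing)
  open import Tactic.RingSolver using (solve-∀)
  open import Algebra.Definitions.RawSemiring +-*-rawSemiring public using (_^_)
  open ≡-Reasoning

  ℚ-ring : AlmostCommutativeRing 0ℓ 0ℓ
  ℚ-ring = fromCommutativeRing +-*-commutativeRing λ x → dec⇒maybe (0ℚ ≟ x)

  fromℕ : ℕ → ℚ
  fromℕ n = + n / 1

  private
    toℚᵘ-/ : ∀ i d → toℚᵘ (i / suc d) ℚᵘ.≃ ℚᵘ.mkℚᵘ i d
    toℚᵘ-/ i d = toℚᵘ-fromℚᵘ (ℚᵘ.mkℚᵘ i d)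

    via-ℚᵘ : ∀ {p q p′ q′} → toℚᵘ p ℚᵘ.≃ p′ → toℚᵘ q ℚᵘ.≃ q′ → p′ ℚᵘ.≃ q′ → p ≡ q
    via-ℚᵘ p≃ q≃ p′≃q′ = toℚᵘ-injective (ℚᵘ.≃-trans p≃ (ℚᵘ.≃-trans p′≃q′ (ℚᵘ.≃-sym q≃)))

  fromℕ-+ : ∀ m n → fromℕ (m ℕ.+ n) ≡ fromℕ m + fromℕ n
  fromℕ-+ m n = via-ℚᵘ (toℚᵘ-/ (+ (m ℕ.+ n)) 0)
    (ℚᵘ.≃-trans (toℚᵘ-homo-+ (fromℕ m) (fromℕ n)) (ℚᵘ.+-cong (toℚᵘ-/ (+ m) 0) (toℚᵘ-/ (+ n) 0)))
    (ℚᵘ.*≡* (cong (ℤ._* + 1) (trans (ℤ.pos-+ m n) (sym (cong₂ ℤ._+_ (ℤ.*-identityʳ (+ m)) (ℤ.*-identityʳ (+ n)))))))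

  fromℕ-* : ∀ m n → fromℕ (m ℕ.* n) ≡ fromℕ m * fromℕ n
  fromℕ-* m n = via-ℚᵘ (toℚᵘ-/ (+ (m ℕ.* n)) 0)
    (ℚᵘ.≃-trans (toℚᵘ-homo-* (fromℕ m) (fromℕ n)) (ℚᵘ.*-cong (toℚᵘ-/ (+ m) 0) (toℚᵘ-/ (+ n) 0)))
    (ℚᵘ.*≡* (cong (ℤ._* + 1) (ℤ.pos-* m n)))

  fromℕ-suc*inv : ∀ n → fromℕ (suc n) * inv (suc n) ≡ 1ℚ
  fromℕ-suc*inv n = via-ℚᵘ
    (ℚᵘ.≃-trans (toℚᵘ-homo-* (fromℕ (suc n)) (inv (suc n))) (ℚᵘ.*-cong (toℚᵘ-/ (+ suc n) 0) (toℚᵘ-/ (+ 1) n)))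
    (toℚᵘ-/ (+ 1) 0)
    (ℚᵘ.*≡* (trans (ℤ.*-identityʳ _) (trans (ℤ.*-identityʳ _) (sym (trans (ℤ.*-identityˡ _) (cong +_ (ℕ.*-identityˡ (suc n))))))))

  /-*-fromℕ : ∀ i d .{{_ : ℕ.NonZero d}} → (i / d) * fromℕ d ≡ i / 1
  /-*-fromℕ i (suc d) = via-ℚᵘ
    (ℚᵘ.≃-trans (toℚᵘ-homo-* (i / suc d) (fromℕ (suc d))) (ℚᵘ.*-cong (toℚᵘ-/ i d) (toℚᵘ-/ (+ suc d) 0)))
    (toℚᵘ-/ i 0)
    (ℚᵘ.*≡* (trans (ℤ.*-identityʳ _) (cong (λ k → i ℤ.* + k) (sym (ℕ.*-identityʳ (suc d))))))

  fromℕ-suc : ∀ n → fromℕ (suc n) ≡ 1ℚ + fromℕ n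
  fromℕ-suc = fromℕ-+ 1

  fromℕ-suc-* : ∀ n x → fromℕ (suc n) * x ≡ x + fromℕ n * x
  fromℕ-suc-* n x = trans (cong (_* x) (fromℕ-suc n))
    (trans (*-distribʳ-+ x 1ℚ (fromℕ n)) (cong (_+ fromℕ n * x) (*-identityˡ x)))

  fromℕ-suc-cancelˡ : ∀ n {x y} → fromℕ (suc n) * x ≡ fromℕ (suc n) * y → x ≡ y
  fromℕ-suc-cancelˡ n {x} {y} eq = begin
    x                                    ≡⟨ cancel x ⟨
    inv (suc n) * (fromℕ (suc n) * x)    ≡⟨ cong (inv (suc n) *_) eq ⟩
    inv (suc n) * (fromℕ (suc n) * y)    ≡⟨ cancel y ⟩
    y                                    ∎
    where
    cancel : ∀ z → inv (suc n) * (fromℕ (suc n) * z) ≡ z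
    cancel z = trans (sym (*-assoc (inv (suc n)) (fromℕ (suc n)) z))
      (trans (cong (_* z) (trans (*-comm (inv (suc n)) (fromℕ (suc n))) (fromℕ-suc*inv n))) (*-identityˡ z))

  invFact : ℕ → ℚ
  invFact zero    = 1ℚ
  invFact (suc n) = invFact n * inv (suc n)

  fromℕ-!*invFact : ∀ n → fromℕ (n !) * invFact n ≡ 1ℚ
  fromℕ-!*invFact zero    = refl
  fromℕ-!*invFact (suc n) = begin
    fromℕ (suc n ℕ.* n !) * (invFact n * inv (suc n))
      ≡⟨ cong (_* (invFact n * inv (suc n))) (fromℕ-* (suc n) (n !)) ⟩
    fromℕ (suc n) * fromℕ (n !) * (invFact n * inv (suc n))
      ≡⟨ regroup (fromℕ (suc n)) (fromℕ (n !)) (invFact n) (inv (suc n)) ⟩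
    (fromℕ (suc n) * inv (suc n)) * (fromℕ (n !) * invFact n)
      ≡⟨ cong₂ _*_ (fromℕ-suc*inv n) (fromℕ-!*invFact n) ⟩
    1ℚ ∎
    where
    regroup : ∀ a b c d → a * b * (c * d) ≡ (a * d) * (b * c)
    regroup = solve-∀ ℚ-ring

  fromℕ-*invFact : ∀ m n → fromℕ m * invFact n ≡ divFact (+ m) n
  fromℕ-*invFact m n = begin
    fromℕ m * invFact n                  ≡⟨ cong (_* invFact n) (/-*-fromℕ (+ m) (n !) {{n ℕ.!≢0}}) ⟨
    q * fromℕ (n !) * invFact n          ≡⟨ *-assoc q (fromℕ (n !)) (invFact n) ⟩
    q * (fromℕ (n !) * invFact n)        ≡⟨ cong (q *_) (fromℕ-!*invFact n) ⟩
    q * 1ℚ                               ≡⟨ *-identityʳ q ⟩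
    q                                    ∎
    where
    q = divFact (+ m) n

  fromℕ-suc-*-invFact : ∀ k x → fromℕ (suc k) * (x * invFact (suc k)) ≡ x * invFact k
  fromℕ-suc-*-invFact k x = begin
    fromℕ (suc k) * (x * (invFact k * inv (suc k)))  ≡⟨ regroup (fromℕ (suc k)) x (invFact k) (inv (suc k)) ⟩
    (fromℕ (suc k) * inv (suc k)) * (x * invFact k)  ≡⟨ cong (_* (x * invFact k)) (fromℕ-suc*inv k) ⟩
    1ℚ * (x * invFact k)                             ≡⟨ *-identityˡ (x * invFact k) ⟩
    x * invFact k                                    ∎
    where
    regroup : ∀ s x i r → s * (x * (i * r)) ≡ (s * r) * (x * i)
    regroup = solve-∀ ℚ-ring

  fromℕ-^ : ∀ m k → fromℕ (m ℕ.^ k) ≡ fromℕ m ^ k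
  fromℕ-^ m zero    = refl
  fromℕ-^ m (suc k) = trans (fromℕ-* m (m ℕ.^ k)) (cong (fromℕ m *_) (fromℕ-^ m k))

module Convolution where
  open Arithmetic
  open import Data.Nat as ℕ using (ℕ; zero; suc; _≤_; z≤n; s≤s)
  import Data.Nat.Properties as ℕ
  open import Data.Rational using (ℚ; 0ℚ; 1ℚ; _+_; _*_; -_; _-_)
  open import Data.Rational.Properties
  open import Relation.Binary.PropositionalEquality
  open import Tactic.RingSolver using (solve-∀)
  open ≡-Reasoning

  Seq : Set
  Seq = ℕ → ℚ

  tail : Seq → Seq
  tail a k = a (suc k)

  delay : Seq → Seq
  delay a zero    = 0ℚ
  delay a (suc k) = a k

  -- θ and ∂ act on the generating function Σ a k xᵏ as x·d/dx and d/dx.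
  θ : Seq → Seq
  θ a k = fromℕ k * a k

  ∂ : Seq → Seq
  ∂ a = tail (θ a)

  infixl 7 _⋆_
  _⋆_ : Seq → Seq → Seq
  (a ⋆ b) zero    = a 0 * b 0
  (a ⋆ b) (suc n) = a 0 * b (suc n) + (tail a ⋆ b) n

  ⋆-cong : ∀ n {a a′ b b′} → (∀ k → k ≤ n → a k ≡ a′ k) → (∀ k → k ≤ n → b k ≡ b′ k) →
           (a ⋆ b) n ≡ (a′ ⋆ b′) n
  ⋆-cong zero    a≡ b≡ = cong₂ _*_ (a≡ 0 z≤n) (b≡ 0 z≤n)
  ⋆-cong (suc n) a≡ b≡ = cong₂ _+_ (cong₂ _*_ (a≡ 0 z≤n) (b≡ (suc n) ℕ.≤-refl))
    (⋆-cong n (λ k k≤n → a≡ (suc k) (s≤s k≤n)) (λ k k≤n → b≡ k (ℕ.m≤n⇒m≤1+n k≤n)))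

  ⋆-distribʳ-+ : ∀ n a a′ b → ((λ k → a k + a′ k) ⋆ b) n ≡ (a ⋆ b) n + (a′ ⋆ b) n
  ⋆-distribʳ-+ zero    a a′ b = *-distribʳ-+ (b 0) (a 0) (a′ 0)
  ⋆-distribʳ-+ (suc n) a a′ b = begin
    (a 0 + a′ 0) * b (suc n) + ((λ k → a (suc k) + a′ (suc k)) ⋆ b) n
      ≡⟨ cong ((a 0 + a′ 0) * b (suc n) +_) (⋆-distribʳ-+ n (tail a) (tail a′) b) ⟩
    (a 0 + a′ 0) * b (suc n) + ((tail a ⋆ b) n + (tail a′ ⋆ b) n)
      ≡⟨ interchange (a 0) (a′ 0) (b (suc n)) _ _ ⟩
    (a ⋆ b) (suc n) + (a′ ⋆ b) (suc n) ∎
    where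
    interchange : ∀ x x′ y u v → (x + x′) * y + (u + v) ≡ (x * y + u) + (x′ * y + v)
    interchange = solve-∀ ℚ-ring

  ⋆-scaleˡ : ∀ n c a b → ((λ k → c * a k) ⋆ b) n ≡ c * (a ⋆ b) n
  ⋆-scaleˡ zero    c a b = *-assoc c (a 0) (b 0)
  ⋆-scaleˡ (suc n) c a b = begin
    c * a 0 * b (suc n) + ((λ k → c * a (suc k)) ⋆ b) n
      ≡⟨ cong₂ _+_ (*-assoc c (a 0) (b (suc n))) (⋆-scaleˡ n c (tail a) b) ⟩
    c * (a 0 * b (suc n)) + c * (tail a ⋆ b) n
      ≡⟨ *-distribˡ-+ c _ _ ⟨
    c * (a ⋆ b) (suc n) ∎

  ⋆-last : ∀ n a b → (a ⋆ b) (suc n) ≡ (a ⋆ tail b) n + a (suc n) * b 0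
  ⋆-last zero    a b = refl
  ⋆-last (suc n) a b = begin
    a 0 * b (suc (suc n)) + (tail a ⋆ b) (suc n)
      ≡⟨ cong (a 0 * b (suc (suc n)) +_) (⋆-last n (tail a) b) ⟩
    a 0 * b (suc (suc n)) + ((tail a ⋆ tail b) n + a (suc (suc n)) * b 0)
      ≡⟨ +-assoc (a 0 * b (suc (suc n))) _ _ ⟨
    (a ⋆ tail b) (suc n) + a (suc (suc n)) * b 0 ∎

  ⋆-comm : ∀ n a b → (a ⋆ b) n ≡ (b ⋆ a) n
  ⋆-comm zero    a b = *-comm (a 0) (b 0)
  ⋆-comm (suc n) a b = begin
    a 0 * b (suc n) + (tail a ⋆ b) n  ≡⟨ cong (a 0 * b (suc n) +_) (⋆-comm n (tail a) b) ⟩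
    a 0 * b (suc n) + (b ⋆ tail a) n  ≡⟨ +-comm (a 0 * b (suc n)) _ ⟩
    (b ⋆ tail a) n + a 0 * b (suc n)  ≡⟨ cong ((b ⋆ tail a) n +_) (*-comm (a 0) (b (suc n))) ⟩
    (b ⋆ tail a) n + b (suc n) * a 0  ≡⟨ ⋆-last n b a ⟨
    (b ⋆ a) (suc n)                   ∎

  ⋆-scaleʳ : ∀ n c a b → (a ⋆ (λ k → c * b k)) n ≡ c * (a ⋆ b) n
  ⋆-scaleʳ n c a b = begin
    (a ⋆ (λ k → c * b k)) n  ≡⟨ ⋆-comm n a _ ⟩
    ((λ k → c * b k) ⋆ a) n  ≡⟨ ⋆-scaleˡ n c b a ⟩
    c * (b ⋆ a) n            ≡⟨ cong (c *_) (⋆-comm n b a) ⟩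
    c * (a ⋆ b) n            ∎

  ⋆-distribˡ-+ : ∀ n a b b′ → (a ⋆ (λ k → b k + b′ k)) n ≡ (a ⋆ b) n + (a ⋆ b′) n
  ⋆-distribˡ-+ n a b b′ = begin
    (a ⋆ (λ k → b k + b′ k)) n  ≡⟨ ⋆-comm n a _ ⟩
    ((λ k → b k + b′ k) ⋆ a) n  ≡⟨ ⋆-distribʳ-+ n b b′ a ⟩
    (b ⋆ a) n + (b′ ⋆ a) n      ≡⟨ cong₂ _+_ (⋆-comm n b a) (⋆-comm n b′ a) ⟩
    (a ⋆ b) n + (a ⋆ b′) n      ∎

  ⋆-delayʳ : ∀ n a b → (a ⋆ delay b) (suc n) ≡ (a ⋆ b) n
  ⋆-delayʳ zero    a b = trans (cong (a 0 * b 0 +_) (*-zeroʳ (a 1))) (+-identityʳ (a 0 * b 0))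
  ⋆-delayʳ (suc n) a b = cong (a 0 * b (suc n) +_) (⋆-delayʳ n (tail a) b)

  θ-⋆ : ∀ n a b → fromℕ n * (a ⋆ b) n ≡ (θ a ⋆ b) n + (a ⋆ θ b) n
  θ-⋆ zero    a b = zero-case (a 0) (b 0)
    where
    zero-case : ∀ x y → 0ℚ * (x * y) ≡ 0ℚ * x * y + x * (0ℚ * y)
    zero-case = solve-∀ ℚ-ring
  θ-⋆ (suc n) a b = begin
    fromℕ (suc n) * (a 0 * b (suc n) + X)
      ≡⟨ *-distribˡ-+ (fromℕ (suc n)) _ X ⟩
    fromℕ (suc n) * (a 0 * b (suc n)) + fromℕ (suc n) * X
      ≡⟨ cong (fromℕ (suc n) * (a 0 * b (suc n)) +_) (fromℕ-suc-* n X) ⟩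
    fromℕ (suc n) * (a 0 * b (suc n)) + (X + fromℕ n * X)
      ≡⟨ cong (λ t → fromℕ (suc n) * (a 0 * b (suc n)) + (X + t)) (θ-⋆ n (tail a) b) ⟩
    fromℕ (suc n) * (a 0 * b (suc n)) + (X + ((θ (tail a) ⋆ b) n + (tail a ⋆ θ b) n))
      ≡⟨ regroup (fromℕ (suc n)) (a 0) (b (suc n)) X _ _ ⟩
    0ℚ * a 0 * b (suc n) + (X + (θ (tail a) ⋆ b) n) + (a 0 * θ b (suc n) + (tail a ⋆ θ b) n)
      ≡⟨ cong (λ t → 0ℚ * a 0 * b (suc n) + t + (a ⋆ θ b) (suc n)) tail-θ ⟨
    (θ a ⋆ b) (suc n) + (a ⋆ θ b) (suc n) ∎
    where
    X = (tail a ⋆ b) n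
    regroup : ∀ s x y u v w → s * (x * y) + (u + (v + w)) ≡ 0ℚ * x * y + (u + v) + (x * (s * y) + w)
    regroup = solve-∀ ℚ-ring
    tail-θ : (tail (θ a) ⋆ b) n ≡ X + (θ (tail a) ⋆ b) n
    tail-θ = trans (⋆-cong n (λ k _ → fromℕ-suc-* k (a (suc k))) (λ _ _ → refl))
                   (⋆-distribʳ-+ n (tail a) (θ (tail a)) b)

  ∂-⋆ : ∀ n a b → fromℕ (suc n) * (a ⋆ b) (suc n) ≡ (∂ a ⋆ b) n + (a ⋆ ∂ b) n
  ∂-⋆ n a b = begin
    fromℕ (suc n) * (a ⋆ b) (suc n)              ≡⟨ θ-⋆ (suc n) a b ⟩
    (θ a ⋆ b) (suc n) + (a ⋆ θ b) (suc n)        ≡⟨ cong₂ _+_ θ-head θ-delay ⟩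
    (∂ a ⋆ b) n + (a ⋆ ∂ b) n                    ∎
    where
    θ-head : (θ a ⋆ b) (suc n) ≡ (∂ a ⋆ b) n
    θ-head = trans (cong (_+ (∂ a ⋆ b) n) (trans (*-assoc 0ℚ (a 0) (b (suc n))) (*-zeroˡ (a 0 * b (suc n))))) (+-identityˡ ((∂ a ⋆ b) n))
    θ≗delay∂ : ∀ k → k ≤ suc n → θ b k ≡ delay (∂ b) k
    θ≗delay∂ zero    _ = *-zeroˡ (b 0)
    θ≗delay∂ (suc k) _ = refl
    θ-delay : (a ⋆ θ b) (suc n) ≡ (a ⋆ ∂ b) n
    θ-delay = trans (⋆-cong (suc n) {a = a} (λ _ _ → refl) θ≗delay∂) (⋆-delayʳ n a (∂ b))

  ⋆-recurrence : ∀ n u v → u 0 ≡ 1ℚ → (u ⋆ v) (suc n) ≡ 0ℚ → ((λ k → - u (suc k)) ⋆ v) n ≡ v (suc n)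
  ⋆-recurrence n u v u₀≡1 uv≡0 = begin
    ((λ k → - u (suc k)) ⋆ v) n        ≡⟨ ⋆-cong n (λ k _ → -x≡-1*x (u (suc k))) (λ _ _ → refl) ⟩
    ((λ k → - 1ℚ * u (suc k)) ⋆ v) n   ≡⟨ ⋆-scaleˡ n (- 1ℚ) (tail u) v ⟩
    - 1ℚ * T                           ≡⟨ -1*t≡s-[s+t] (v (suc n)) T ⟩
    v (suc n) - (v (suc n) + T)        ≡⟨ cong (λ t → v (suc n) - t) v+T≡0 ⟩
    v (suc n) - 0ℚ                     ≡⟨ +-identityʳ (v (suc n)) ⟩
    v (suc n)                          ∎
    where
    T = (tail u ⋆ v) n
    -x≡-1*x : ∀ x → - x ≡ - 1ℚ * x
    -x≡-1*x = solve-∀ ℚ-ring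
    -1*t≡s-[s+t] : ∀ s t → - 1ℚ * t ≡ s - (s + t)
    -1*t≡s-[s+t] = solve-∀ ℚ-ring
    v+T≡0 : v (suc n) + T ≡ 0ℚ
    v+T≡0 = trans (cong (_+ T) (sym (trans (cong (_* v (suc n)) u₀≡1) (*-identityˡ (v (suc n)))))) uv≡0

module BinomialSequences (c : ℚ) where
  open Arithmetic
  open Convolution
  open import Data.Nat using (ℕ; zero; suc)
  open import Data.Rational using (ℚ; 0ℚ; 1ℚ; _+_; _*_)
  open import Data.Rational.Properties
  open import Relation.Binary.PropositionalEquality
  open import Tactic.RingSolver using (solve-∀)
  open ≡-Reasoning

  -- Taking ∂ of both sides reduces the identity at n + 1 to the mixed identity at n.
  binomial-⋆-step : ∀ (a b : ℚ → Seq) n →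
    (∀ x k → ∂ (a x) k ≡ x * b (x + c) k) →
    (∀ x y → (a x ⋆ b y) n ≡ b (x + y) n) →
    ∀ x y → (a x ⋆ a y) (suc n) ≡ a (x + y) (suc n)
  binomial-⋆-step a b n ∂a a⋆b x y = fromℕ-suc-cancelˡ n (begin
    fromℕ (suc n) * (a x ⋆ a y) (suc n)
      ≡⟨ ∂-⋆ n (a x) (a y) ⟩
    (∂ (a x) ⋆ a y) n + (a x ⋆ ∂ (a y)) n
      ≡⟨ cong₂ _+_ (⋆-cong n (λ k _ → ∂a x k) (λ _ _ → refl)) (⋆-cong n {a = a x} (λ _ _ → refl) (λ k _ → ∂a y k)) ⟩
    ((λ k → x * b (x + c) k) ⋆ a y) n + (a x ⋆ (λ k → y * b (y + c) k)) n
      ≡⟨ cong₂ _+_ (⋆-scaleˡ n x (b (x + c)) (a y)) (⋆-scaleʳ n y (a x) (b (y + c))) ⟩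
    x * (b (x + c) ⋆ a y) n + y * (a x ⋆ b (y + c)) n
      ≡⟨ cong (λ t → x * t + y * (a x ⋆ b (y + c)) n) (⋆-comm n (b (x + c)) (a y)) ⟩
    x * (a y ⋆ b (x + c)) n + y * (a x ⋆ b (y + c)) n
      ≡⟨ cong₂ (λ s t → x * s + y * t) (a⋆b y (x + c)) (a⋆b x (y + c)) ⟩
    x * b (y + (x + c)) n + y * b (x + (y + c)) n
      ≡⟨ cong₂ (λ s t → x * b s n + y * b t n) (y+[x+c] x y c) (+-assoc x y c) ⟨
    x * b (x + y + c) n + y * b (x + y + c) n
      ≡⟨ *-distribʳ-+ (b (x + y + c) n) x y ⟨
    (x + y) * b (x + y + c) n
      ≡⟨ ∂a (x + y) n ⟨
    fromℕ (suc n) * a (x + y) (suc n) ∎)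
    where
    y+[x+c] : ∀ x y c → x + y + c ≡ y + (x + c)
    y+[x+c] = solve-∀ ℚ-ring

  +c*fromℕ-suc : ∀ x k → x + c * fromℕ (suc k) ≡ (x + c) + c * fromℕ k
  +c*fromℕ-suc x k = trans (cong (λ t → x + c * t) (fromℕ-suc k)) (regroup x c (fromℕ k))
    where
    regroup : ∀ x c i → x + c * (1ℚ + i) ≡ (x + c) + c * i
    regroup = solve-∀ ℚ-ring

  rising : ℕ → ℚ → ℚ
  rising zero    x = 1ℚ
  rising (suc n) x = x * rising n (x + c)

  risingSeq : ℚ → Seq
  risingSeq x n = rising n x * invFact n

  ∂-risingSeq : ∀ x k → ∂ (risingSeq x) k ≡ x * risingSeq (x + c) k
  ∂-risingSeq x k = trans (fromℕ-suc-*-invFact k (x * rising k (x + c))) (*-assoc x _ (invFact k))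

  risingSeq-⋆ : ∀ n x y → (risingSeq x ⋆ risingSeq y) n ≡ risingSeq (x + y) n
  risingSeq-⋆ zero    x y = refl
  risingSeq-⋆ (suc n) = binomial-⋆-step risingSeq risingSeq n ∂-risingSeq (risingSeq-⋆ n)

  rising-suc : ∀ n x → rising (suc n) x ≡ rising n x * (x + c * fromℕ n)
  rising-suc zero    x = unit x c
    where
    unit : ∀ x c → x * 1ℚ ≡ 1ℚ * (x + c * 0ℚ)
    unit = solve-∀ ℚ-ring
  rising-suc (suc n) x = begin
    x * rising (suc n) (x + c)                           ≡⟨ cong (x *_) (rising-suc n (x + c)) ⟩
    x * (rising n (x + c) * ((x + c) + c * fromℕ n))     ≡⟨ cong (λ t → x * (rising n (x + c) * t)) (+c*fromℕ-suc x n) ⟨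
    x * (rising n (x + c) * (x + c * fromℕ (suc n)))     ≡⟨ *-assoc x _ _ ⟨
    rising (suc n) x * (x + c * fromℕ (suc n))           ∎

  risingSeq-0-suc : ∀ n → risingSeq 0ℚ (suc n) ≡ 0ℚ
  risingSeq-0-suc n = trans (cong (_* invFact (suc n)) (*-zeroˡ (rising n (0ℚ + c)))) (*-zeroˡ (invFact (suc n)))

  abel : ℕ → ℚ → ℚ
  abel zero    x = 1ℚ
  abel (suc n) x = x * (x + c * fromℕ (suc n)) ^ n

  abelSeq : ℚ → Seq
  abelSeq x n = abel n x * invFact n

  abelPowSeq : ℚ → Seq
  abelPowSeq x n = (x + c * fromℕ n) ^ n * invFact n

  ∂-abelSeq : ∀ x k → ∂ (abelSeq x) k ≡ x * abelPowSeq (x + c) k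
  ∂-abelSeq x k = begin
    fromℕ (suc k) * (x * (x + c * fromℕ (suc k)) ^ k * invFact (suc k))
      ≡⟨ fromℕ-suc-*-invFact k (x * (x + c * fromℕ (suc k)) ^ k) ⟩
    x * (x + c * fromℕ (suc k)) ^ k * invFact k
      ≡⟨ cong (λ t → x * t ^ k * invFact k) (+c*fromℕ-suc x k) ⟩
    x * ((x + c) + c * fromℕ k) ^ k * invFact k
      ≡⟨ *-assoc x _ (invFact k) ⟩
    x * abelPowSeq (x + c) k ∎

  abelPowSeq-suc : ∀ x k → abelPowSeq x (suc k) ≡ abelSeq x (suc k) + c * abelPowSeq (x + c) k
  abelPowSeq-suc x k = begin
    (x + c * S) * M * F
      ≡⟨ split x c S M F ⟩
    x * M * F + c * (S * (M * F))
      ≡⟨ cong (λ t → x * M * F + c * t) (fromℕ-suc-*-invFact k M) ⟩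
    x * M * F + c * (M * invFact k)
      ≡⟨ cong (λ t → x * M * F + c * (t ^ k * invFact k)) (+c*fromℕ-suc x k) ⟩
    abelSeq x (suc k) + c * abelPowSeq (x + c) k ∎
    where
    S = fromℕ (suc k)
    M = (x + c * S) ^ k
    F = invFact (suc k)
    split : ∀ x c s m f → (x + c * s) * m * f ≡ x * m * f + c * (s * (m * f))
    split = solve-∀ ℚ-ring

  abelPowSeq-split : ∀ x k → abelPowSeq x k ≡ abelSeq x k + c * delay (abelPowSeq (x + c)) k
  abelPowSeq-split x zero    = sym (trans (cong (1ℚ * 1ℚ +_) (*-zeroʳ c)) (+-identityʳ (1ℚ * 1ℚ)))
  abelPowSeq-split x (suc k) = abelPowSeq-suc x k

  abelSeq-0-suc : ∀ n → abelSeq 0ℚ (suc n) ≡ 0ℚ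
  abelSeq-0-suc n = trans (cong (_* invFact (suc n)) (*-zeroˡ ((0ℚ + c * fromℕ (suc n)) ^ n))) (*-zeroˡ (invFact (suc n)))

  mutual
    abelSeq-⋆-abelPowSeq : ∀ n x y → (abelSeq x ⋆ abelPowSeq y) n ≡ abelPowSeq (x + y) n
    abelSeq-⋆-abelPowSeq zero    x y = refl
    abelSeq-⋆-abelPowSeq (suc n) x y = begin
      (abelSeq x ⋆ abelPowSeq y) (suc n)
        ≡⟨ ⋆-cong (suc n) {a = abelSeq x} (λ _ _ → refl) (λ k _ → abelPowSeq-split y k) ⟩
      (abelSeq x ⋆ (λ k → abelSeq y k + c * delay (abelPowSeq (y + c)) k)) (suc n)
        ≡⟨ ⋆-distribˡ-+ (suc n) (abelSeq x) (abelSeq y) _ ⟩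
      (abelSeq x ⋆ abelSeq y) (suc n) + (abelSeq x ⋆ (λ k → c * delay (abelPowSeq (y + c)) k)) (suc n)
        ≡⟨ cong₂ _+_ (abelSeq-⋆ (suc n) x y) (⋆-scaleʳ (suc n) c (abelSeq x) (delay (abelPowSeq (y + c)))) ⟩
      abelSeq (x + y) (suc n) + c * (abelSeq x ⋆ delay (abelPowSeq (y + c))) (suc n)
        ≡⟨ cong (λ t → abelSeq (x + y) (suc n) + c * t) (⋆-delayʳ n (abelSeq x) (abelPowSeq (y + c))) ⟩
      abelSeq (x + y) (suc n) + c * (abelSeq x ⋆ abelPowSeq (y + c)) n
        ≡⟨ cong (λ t → abelSeq (x + y) (suc n) + c * t) (abelSeq-⋆-abelPowSeq n x (y + c)) ⟩
      abelSeq (x + y) (suc n) + c * abelPowSeq (x + (y + c)) n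
        ≡⟨ cong (λ z → abelSeq (x + y) (suc n) + c * abelPowSeq z n) (+-assoc x y c) ⟨
      abelSeq (x + y) (suc n) + c * abelPowSeq (x + y + c) n
        ≡⟨ abelPowSeq-suc (x + y) n ⟨
      abelPowSeq (x + y) (suc n) ∎

    abelSeq-⋆ : ∀ n x y → (abelSeq x ⋆ abelSeq y) n ≡ abelSeq (x + y) n
    abelSeq-⋆ zero    x y = refl
    abelSeq-⋆ (suc n) = binomial-⋆-step abelSeq abelPowSeq n ∂-abelSeq (abelSeq-⋆-abelPowSeq n)

module ForestEnumeration where
  open import Data.Nat as ℕ using (ℕ; zero; suc; _+_; _≤_; s≤s)
  import Data.Nat.Properties as ℕ
  open import Data.List using (List; []; _∷_; _++_; cartesianProductWith)
  open import Data.List.Membership.Propositional using (_∈_)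
  open import Data.List.Membership.Propositional.Properties
    using (∈-++⁺ˡ; ∈-++⁺ʳ; ∈-++⁻; ∈-cartesianProductWith⁺; ∈-cartesianProductWith⁻)
  open import Data.List.Relation.Unary.Any using (here)
  open import Data.List.Relation.Unary.Unique.Propositional using (Unique; []; _∷_)
  open import Data.List.Relation.Unary.Unique.Propositional.Properties using (++⁺; cartesianProductWith⁺)
  open import Data.List.Relation.Unary.All using ([])
  open import Data.Product using (_×_; _,_; proj₁)
  open import Data.Sum using (inj₁; inj₂)
  open import Data.Empty using (⊥)
  open import Function using (_∘_; _⇔_; mk⇔)
  import Function.Properties.Equivalence as ⇔
  open import Data.List.Relation.Binary.Permutation.Propositional using (_↭_)
  open import Data.List.Membership.Propositional.Properties.WithK using (unique∧set⇒bag)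
  open import Data.List.Relation.Binary.BagAndSetEquality using (∼bag⇒↭)
  open import Relation.Binary.PropositionalEquality

  plant : PlaneForest → PlaneForest → PlaneForest
  plant ts F = node ts ∷ F

  plant-injective : ∀ {ts ts′ F F′} → plant ts F ≡ plant ts′ F′ → ts ≡ ts′ × F ≡ F′
  plant-injective refl = refl , refl

  graft : List PlaneForest → List PlaneForest → List PlaneForest
  graft = cartesianProductWith plant

  Family : Set
  Family = ℕ → List PlaneForest

  infixl 7 _⊛_
  _⊛_ : Family → Family → Family
  (G ⊛ H) zero    = graft (G 0) (H 0)
  (G ⊛ H) (suc n) = graft (G 0) (H (suc n)) ++ ((G ∘ suc) ⊛ H) n

  record ⊛-Member (G H : Family) (n : ℕ) (F : PlaneForest) : Set where
    constructor member
    field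
      {k m}   : ℕ
      {ts F′} : PlaneForest
      k+m≡n   : k + m ≡ n
      ts∈G    : ts ∈ G k
      F′∈H    : F′ ∈ H m
      F≡      : F ≡ plant ts F′

  ∈-graft⁻ : ∀ G H k m {n F} → k + m ≡ n → F ∈ graft (G k) (H m) → ⊛-Member G H n F
  ∈-graft⁻ G H k m k+m≡n F∈ with ∈-cartesianProductWith⁻ plant (G k) (H m) F∈
  ... | ts , F′ , ts∈ , F′∈ , F≡ = member k+m≡n ts∈ F′∈ F≡

  ∈-⊛⁻ : ∀ G H n {F} → F ∈ (G ⊛ H) n → ⊛-Member G H n F
  ∈-⊛⁻ G H zero    F∈ = ∈-graft⁻ G H 0 0 refl F∈
  ∈-⊛⁻ G H (suc n) F∈ with ∈-++⁻ (graft (G 0) (H (suc n))) F∈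
  ... | inj₁ F∈graft = ∈-graft⁻ G H 0 (suc n) refl F∈graft
  ... | inj₂ F∈rest  with ∈-⊛⁻ (G ∘ suc) H n F∈rest
  ...   | member k+m≡n ts∈ F′∈ F≡ = member (cong suc k+m≡n) ts∈ F′∈ F≡

  ∈-⊛⁺ : ∀ G H {n k m ts F} → k + m ≡ n → ts ∈ G k → F ∈ H m → plant ts F ∈ (G ⊛ H) n
  ∈-⊛⁺ G H {zero}  {zero} refl ts∈ F∈ = ∈-cartesianProductWith⁺ plant ts∈ F∈
  ∈-⊛⁺ G H {suc n} {zero} refl ts∈ F∈ = ∈-++⁺ˡ (∈-cartesianProductWith⁺ plant ts∈ F∈)
  ∈-⊛⁺ G H {suc n} {suc k} k+m≡n ts∈ F∈ =
    ∈-++⁺ʳ (graft (G 0) (H (suc n))) (∈-⊛⁺ (G ∘ suc) H (ℕ.suc-injective k+m≡n) ts∈ F∈)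

  graft-unique : ∀ {xs ys} → Unique xs → Unique ys → Unique (graft xs ys)
  graft-unique = cartesianProductWith⁺ plant plant-injective

  ⊛-unique : ∀ G H n → (∀ k → Unique (G k)) → (∀ k → Unique (H k)) →
             (∀ {j k ts} → ts ∈ G j → ts ∈ G k → j ≡ k) → Unique ((G ⊛ H) n)
  ⊛-unique G H zero    G! H! index = graft-unique (G! 0) (H! 0)
  ⊛-unique G H (suc n) G! H! index =
    ++⁺ (graft-unique (G! 0) (H! (suc n)))
        (⊛-unique (G ∘ suc) H n (G! ∘ suc) H! (λ ts∈ ts∈′ → ℕ.suc-injective (index ts∈ ts∈′)))
        disjoint
    where
    disjoint : ∀ {F} → F ∈ graft (G 0) (H (suc n)) × F ∈ ((G ∘ suc) ⊛ H) n → ⊥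
    disjoint (F∈graft , F∈rest)
      with ∈-cartesianProductWith⁻ plant (G 0) (H (suc n)) F∈graft | ∈-⊛⁻ (G ∘ suc) H n F∈rest
    ... | ts , _ , ts∈ , _ , refl | member _ ts′∈ _ F≡
      with index ts∈ (subst (_∈ _) (sym (proj₁ (plant-injective F≡))) ts′∈)
    ... | ()

  -- The first argument is fuel: forestsWithin f n lists the forests of size n whenever n ≤ f.
  forestsWithin : ℕ → Family
  forestsWithin f       zero    = [] ∷ []
  forestsWithin zero    (suc n) = []
  forestsWithin (suc f) (suc n) = (forestsWithin f ⊛ forestsWithin f) n

  forests : Family
  forests n = forestsWithin n n

  forestsWithin-sound : ∀ f n {F} → F ∈ forestsWithin f n → forestSize F ≡ n
  forestsWithin-sound f       zero    (here refl) = refl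
  forestsWithin-sound (suc f) (suc n) F∈ with ∈-⊛⁻ (forestsWithin f) (forestsWithin f) n F∈
  ... | member {k} {m} k+m≡n ts∈ F′∈ refl =
    cong suc (trans (cong₂ _+_ (forestsWithin-sound f k ts∈) (forestsWithin-sound f m F′∈)) k+m≡n)

  forestsWithin-complete : ∀ f F → forestSize F ≤ f → F ∈ forestsWithin f (forestSize F)
  forestsWithin-complete f       []            _         = here refl
  forestsWithin-complete (suc f) (node ts ∷ F) (s≤s |F|≤f) =
    ∈-⊛⁺ (forestsWithin f) (forestsWithin f) {k = forestSize ts} {m = forestSize F} refl
      (forestsWithin-complete f ts (ℕ.≤-trans (ℕ.m≤m+n _ _) |F|≤f))
      (forestsWithin-complete f F (ℕ.≤-trans (ℕ.m≤n+m _ _) |F|≤f))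

  forestsWithin-unique : ∀ f n → Unique (forestsWithin f n)
  forestsWithin-unique f       zero    = [] ∷ []
  forestsWithin-unique zero    (suc n) = []
  forestsWithin-unique (suc f) (suc n) =
    ⊛-unique (forestsWithin f) (forestsWithin f) n (forestsWithin-unique f) (forestsWithin-unique f)
      (λ {j} {k} ts∈j ts∈k → trans (sym (forestsWithin-sound f j ts∈j)) (forestsWithin-sound f k ts∈k))

  ∈-forests : ∀ n F → F ∈ forests n ⇔ forestSize F ≡ n
  ∈-forests n F = mk⇔ (forestsWithin-sound n n) (λ { refl → forestsWithin-complete n F ℕ.≤-refl })

  forests-unique : ∀ n → Unique (forests n)
  forests-unique n = forestsWithin-unique n n

  ↭-forests : ∀ n {L} → Unique L → (∀ F → F ∈ L ⇔ forestSize F ≡ n) → L ↭ forests n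
  ↭-forests n {L} L! L∈ = ∼bag⇒↭ (unique∧set⇒bag L! (forests-unique n)
    (λ {F} → ⇔.trans (L∈ F) (⇔.sym (∈-forests n F))))

module HookSums (w : ℕ → ℚ) where
  open Arithmetic
  open Convolution
  open ForestEnumeration
  open import Data.Nat as ℕ using (ℕ; zero; suc; _≤_; s≤s)
  import Data.Nat.Properties as ℕ
  open import Data.Rational using (ℚ; 1ℚ; _+_; _*_)
  open import Data.Rational.Properties
  open import Data.List using (List; []; _∷_; _++_; map)
  open import Data.List.Membership.Propositional using (_∈_)
  open import Data.List.Relation.Unary.Any using (here; there)
  open import Data.List.Relation.Binary.Permutation.Propositional using (_↭_; ↭⇒↭ₛ)
  import Data.List.Relation.Binary.Permutation.Propositional.Properties as ↭
  open import Data.List.Relation.Binary.Permutation.Setoid.Properties using (foldr-commMonoid)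
  open import Function using (_∘_)
  open import Relation.Binary.PropositionalEquality
  open ≡-Reasoning

  weight : PlaneForest → ℚ
  weight F = prodℚ (map w (forestHooks F))

  total : List PlaneForest → ℚ
  total L = sumℚ (map weight L)

  rootedWeight : PlaneForest → ℚ
  rootedWeight ts = w (suc (forestSize ts)) * weight ts

  rootedTotal : List PlaneForest → ℚ
  rootedTotal xs = sumℚ (map rootedWeight xs)

  prodℚ-map-++ : ∀ xs ys → prodℚ (map w (xs ++ ys)) ≡ prodℚ (map w xs) * prodℚ (map w ys)
  prodℚ-map-++ []       ys = sym (*-identityˡ (prodℚ (map w ys)))
  prodℚ-map-++ (x ∷ xs) ys =
    trans (cong (w x *_) (prodℚ-map-++ xs ys)) (sym (*-assoc (w x) _ (prodℚ (map w ys))))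

  weight-plant : ∀ ts F → weight (plant ts F) ≡ rootedWeight ts * weight F
  weight-plant ts F = trans (cong (w (suc (forestSize ts)) *_) (prodℚ-map-++ (forestHooks ts) (forestHooks F)))
                            (sym (*-assoc (w (suc (forestSize ts))) (weight ts) (weight F)))

  total-++ : ∀ xs ys → total (xs ++ ys) ≡ total xs + total ys
  total-++ []       ys = sym (+-identityˡ (total ys))
  total-++ (x ∷ xs) ys = trans (cong (weight x +_) (total-++ xs ys)) (sym (+-assoc (weight x) (total xs) (total ys)))

  total-map-plant : ∀ ts ys → total (map (plant ts) ys) ≡ rootedWeight ts * total ys
  total-map-plant ts []       = sym (*-zeroʳ (rootedWeight ts))
  total-map-plant ts (F ∷ ys) = begin
    weight (plant ts F) + total (map (plant ts) ys)  ≡⟨ cong₂ _+_ (weight-plant ts F) (total-map-plant ts ys) ⟩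
    rootedWeight ts * weight F + rootedWeight ts * total ys ≡⟨ *-distribˡ-+ (rootedWeight ts) _ _ ⟨
    rootedWeight ts * total (F ∷ ys) ∎

  total-graft : ∀ xs ys → total (graft xs ys) ≡ rootedTotal xs * total ys
  total-graft []        ys = sym (*-zeroˡ (total ys))
  total-graft (ts ∷ xs) ys = begin
    total (map (plant ts) ys ++ graft xs ys)             ≡⟨ total-++ (map (plant ts) ys) (graft xs ys) ⟩
    total (map (plant ts) ys) + total (graft xs ys)      ≡⟨ cong₂ _+_ (total-map-plant ts ys) (total-graft xs ys) ⟩
    rootedWeight ts * total ys + rootedTotal xs * total ys ≡⟨ *-distribʳ-+ (total ys) (rootedWeight ts) (rootedTotal xs) ⟨
    rootedTotal (ts ∷ xs) * total ys ∎

  total-⊛ : ∀ G H n → total ((G ⊛ H) n) ≡ ((rootedTotal ∘ G) ⋆ (total ∘ H)) n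
  total-⊛ G H zero    = total-graft (G 0) (H 0)
  total-⊛ G H (suc n) = trans (total-++ (graft (G 0) (H (suc n))) _)
    (cong₂ _+_ (total-graft (G 0) (H (suc n))) (total-⊛ (G ∘ suc) H n))

  rootedTotal-sized : ∀ k xs → (∀ {ts} → ts ∈ xs → forestSize ts ≡ k) → rootedTotal xs ≡ w (suc k) * total xs
  rootedTotal-sized k []        _     = sym (*-zeroʳ (w (suc k)))
  rootedTotal-sized k (ts ∷ xs) sized = begin
    w (suc (forestSize ts)) * weight ts + rootedTotal xs
      ≡⟨ cong₂ (λ s t → w (suc s) * weight ts + t) (sized (here refl)) (rootedTotal-sized k xs (sized ∘ there)) ⟩
    w (suc k) * weight ts + w (suc k) * total xs
      ≡⟨ *-distribˡ-+ (w (suc k)) (weight ts) (total xs) ⟨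
    w (suc k) * total (ts ∷ xs) ∎

  total-forestsWithin : (s : Seq) → s 0 ≡ 1ℚ → (∀ n → ((λ k → w (suc k) * s k) ⋆ s) n ≡ s (suc n)) →
                        ∀ f n → n ≤ f → total (forestsWithin f n) ≡ s n
  total-forestsWithin s s₀ rec f       zero    _           = trans (+-identityʳ 1ℚ) (sym s₀)
  total-forestsWithin s s₀ rec (suc f) (suc n) (s≤s n≤f) = begin
    total ((forestsWithin f ⊛ forestsWithin f) n)
      ≡⟨ total-⊛ (forestsWithin f) (forestsWithin f) n ⟩
    ((rootedTotal ∘ forestsWithin f) ⋆ (total ∘ forestsWithin f)) n
      ≡⟨ ⋆-cong n (λ k k≤n → trans (rootedTotal-sized k _ (forestsWithin-sound f k)) (cong (w (suc k) *_) (IH k k≤n))) IH ⟩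
    ((λ k → w (suc k) * s k) ⋆ s) n
      ≡⟨ rec n ⟩
    s (suc n) ∎
    where
    IH : ∀ k → k ≤ n → total (forestsWithin f k) ≡ s k
    IH k k≤n = total-forestsWithin s s₀ rec f k (ℕ.≤-trans k≤n n≤f)

  total-forests : (s : Seq) → s 0 ≡ 1ℚ → (∀ n → ((λ k → w (suc k) * s k) ⋆ s) n ≡ s (suc n)) →
                  ∀ n → total (forests n) ≡ s n
  total-forests s s₀ rec n = total-forestsWithin s s₀ rec n n ℕ.≤-refl

  total-↭ : ∀ {L L′} → L ↭ L′ → total L ≡ total L′
  total-↭ L↭L′ = foldr-commMonoid (setoid ℚ) +-0-isCommutativeMonoid (↭⇒↭ₛ (↭.map⁺ weight L↭L′))

module HookLengthFormulas where
  open Arithmetic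
  open Convolution
  open BinomialSequences (fromℕ 2)
  open ForestEnumeration
  open HookSums
  open import Data.Nat as ℕ using (ℕ; zero; suc; _!; _∸_)
  open import Data.Integer using (+_)
  open import Data.Rational using (ℚ; 1ℚ; _+_; _*_; -_; _-_)
  open import Data.Rational.Properties
  open import Relation.Binary.PropositionalEquality
  open import Tactic.RingSolver using (solve-∀)
  open ≡-Reasoning

  two : ℚ
  two = fromℕ 2

  inv≡-risingSeq : ∀ k → inv (suc k) * risingSeq 1ℚ k ≡ - risingSeq (- 1ℚ) (suc k)
  inv≡-risingSeq k = regroup (rising k 1ℚ) (invFact k) (inv (suc k))
    where
    regroup : ∀ r f i → i * (r * f) ≡ - ((- 1ℚ * r) * (f * i))
    regroup = solve-∀ ℚ-ring

  2-inv≡-abelSeq : ∀ k → (two - inv (suc k)) * abelSeq 1ℚ k ≡ - abelSeq (- 1ℚ) (suc k)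
  2-inv≡-abelSeq zero    = refl
  2-inv≡-abelSeq (suc j) = begin
    (two - r) * (1ℚ * (1ℚ + two * fromℕ (suc j)) ^ j * F)
      ≡⟨ cong (λ t → (two - r) * (1ℚ * t ^ j * F)) base ⟩
    (two - r) * (1ℚ * (- 1ℚ + two * I) ^ j * F)
      ≡⟨ cong (λ t → (two * t - r) * (1ℚ * (- 1ℚ + two * I) ^ j * F)) (fromℕ-suc*inv (suc j)) ⟨
    (two * (I * r) - r) * (1ℚ * (- 1ℚ + two * I) ^ j * F)
      ≡⟨ regroup two I r ((- 1ℚ + two * I) ^ j) F ⟩
    - abelSeq (- 1ℚ) (suc (suc j)) ∎
    where
    I = fromℕ (suc (suc j))
    r = inv (suc (suc j))
    F = invFact (suc j)
    base : 1ℚ + two * fromℕ (suc j) ≡ - 1ℚ + two * I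
    base = trans (shift (fromℕ (suc j))) (cong (λ t → - 1ℚ + two * t) (sym (fromℕ-suc (suc j))))
      where
      -- true only for the step 2, which the solver must see as 1ℚ + 1ℚ
      shift : ∀ i → 1ℚ + (1ℚ + 1ℚ) * i ≡ - 1ℚ + (1ℚ + 1ℚ) * (1ℚ + i)
      shift = solve-∀ ℚ-ring
    regroup : ∀ t i r m f → (t * (i * r) - r) * (1ℚ * m * f) ≡ - ((- 1ℚ * ((- 1ℚ + t * i) * m)) * (f * r))
    regroup = solve-∀ ℚ-ring

  hookSum-inv : ∀ n → total inv (forests n) ≡ risingSeq 1ℚ n
  hookSum-inv = total-forests inv (risingSeq 1ℚ) refl λ n → trans
    (⋆-cong n (λ k _ → inv≡-risingSeq k) (λ _ _ → refl))
    (⋆-recurrence n (risingSeq (- 1ℚ)) (risingSeq 1ℚ) refl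
      (trans (risingSeq-⋆ (suc n) (- 1ℚ) 1ℚ) (risingSeq-0-suc n)))

  hookSum-2-inv : ∀ n → total (λ h → two - inv h) (forests n) ≡ abelSeq 1ℚ n
  hookSum-2-inv = total-forests (λ h → two - inv h) (abelSeq 1ℚ) refl λ n → trans
    (⋆-cong n (λ k _ → 2-inv≡-abelSeq k) (λ _ _ → refl))
    (⋆-recurrence n (abelSeq (- 1ℚ)) (abelSeq 1ℚ) refl
      (trans (abelSeq-⋆ (suc n) (- 1ℚ) 1ℚ) (abelSeq-0-suc n)))

  fromℕ-2n+1 : ∀ n → fromℕ (2 ℕ.* n ℕ.+ 1) ≡ 1ℚ + two * fromℕ n
  fromℕ-2n+1 n = trans (fromℕ-+ (2 ℕ.* n) 1) (trans (cong (_+ 1ℚ) (fromℕ-* 2 n)) (+-comm (two * fromℕ n) 1ℚ))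

  rising-1 : ∀ n → rising n 1ℚ ≡ fromℕ (oddDoubleFact n)
  rising-1 zero    = refl
  rising-1 (suc n) = begin
    rising (suc n) 1ℚ                                  ≡⟨ rising-suc n 1ℚ ⟩
    rising n 1ℚ * (1ℚ + two * fromℕ n)                 ≡⟨ cong₂ _*_ (rising-1 n) (sym (fromℕ-2n+1 n)) ⟩
    fromℕ (oddDoubleFact n) * fromℕ (2 ℕ.* n ℕ.+ 1)    ≡⟨ *-comm (fromℕ (oddDoubleFact n)) _ ⟩
    fromℕ (2 ℕ.* n ℕ.+ 1) * fromℕ (oddDoubleFact n)    ≡⟨ fromℕ-* (2 ℕ.* n ℕ.+ 1) (oddDoubleFact n) ⟨
    fromℕ (oddDoubleFact (suc n))                      ∎

  abel-1 : ∀ n → abel n 1ℚ ≡ fromℕ ((2 ℕ.* n ℕ.+ 1) ℕ.^ (n ∸ 1))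
  abel-1 zero    = refl
  abel-1 (suc j) = begin
    1ℚ * (1ℚ + two * fromℕ (suc j)) ^ j  ≡⟨ *-identityˡ _ ⟩
    (1ℚ + two * fromℕ (suc j)) ^ j       ≡⟨ cong (_^ j) (fromℕ-2n+1 (suc j)) ⟨
    fromℕ (2 ℕ.* suc j ℕ.+ 1) ^ j        ≡⟨ fromℕ-^ (2 ℕ.* suc j ℕ.+ 1) j ⟨
    fromℕ ((2 ℕ.* suc j ℕ.+ 1) ℕ.^ j)    ∎

  n!*hookSum-inv≡oddDoubleFact : ∀ n → fromℕ (n !) * total inv (forests n) ≡ fromℕ (oddDoubleFact n)
  n!*hookSum-inv≡oddDoubleFact n = begin
    fromℕ (n !) * total inv (forests n)            ≡⟨ cong (fromℕ (n !) *_) (hookSum-inv n) ⟩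
    fromℕ (n !) * (rising n 1ℚ * invFact n)        ≡⟨ cong (λ t → fromℕ (n !) * (t * invFact n)) (rising-1 n) ⟩
    fromℕ (n !) * (fromℕ (oddDoubleFact n) * invFact n)
      ≡⟨ x*[y*z]≡y*[x*z] (fromℕ (n !)) (fromℕ (oddDoubleFact n)) (invFact n) ⟩
    fromℕ (oddDoubleFact n) * (fromℕ (n !) * invFact n)
      ≡⟨ cong (fromℕ (oddDoubleFact n) *_) (fromℕ-!*invFact n) ⟩
    fromℕ (oddDoubleFact n) * 1ℚ                   ≡⟨ *-identityʳ _ ⟩
    fromℕ (oddDoubleFact n)                        ∎
    where
    x*[y*z]≡y*[x*z] : ∀ x y z → x * (y * z) ≡ y * (x * z)
    x*[y*z]≡y*[x*z] = solve-∀ ℚ-ring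

  hookSum-2-inv≡divFact : ∀ n → total (λ h → two - inv h) (forests n) ≡ divFact (+ ((2 ℕ.* n ℕ.+ 1) ℕ.^ (n ∸ 1))) n
  hookSum-2-inv≡divFact n = begin
    total (λ h → two - inv h) (forests n)  ≡⟨ hookSum-2-inv n ⟩
    abel n 1ℚ * invFact n                  ≡⟨ cong (_* invFact n) (abel-1 n) ⟩
    fromℕ ((2 ℕ.* n ℕ.+ 1) ℕ.^ (n ∸ 1)) * invFact n ≡⟨ fromℕ-*invFact ((2 ℕ.* n ℕ.+ 1) ℕ.^ (n ∸ 1)) n ⟩
    divFact (+ ((2 ℕ.* n ℕ.+ 1) ℕ.^ (n ∸ 1))) n ∎

open import Data.Nat using (ℕ; _+_; _*_; _∸_; _^_; _!)
open import Data.Integer using (+_)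
open import Data.Rational using (_/_) renaming (_*_ to _*ℚ_; _-_ to _-ℚ_)
open import Data.Product using (Σ; _×_; _,_)
open import Data.List using (List; map)
open import Data.List.Membership.Propositional using (_∈_)
open import Data.List.Relation.Unary.Unique.Propositional using (Unique)
open import Function.Bundles using (_⇔_)
open import Relation.Binary.PropositionalEquality using (_≡_; cong; trans)
open ForestEnumeration using (forests; forests-unique; ∈-forests; ↭-forests)
open HookSums using (total-↭)
open HookLengthFormulas using (n!*hookSum-inv≡oddDoubleFact; hookSum-2-inv≡divFact)

corollary4p5 : (n : ℕ) →
  Σ (List PlaneForest) (λ L → Unique L × ((F : PlaneForest) → (F ∈ L) ⇔ (forestSize F ≡ n)))
  × ((L : List PlaneForest) → Unique L → ((F : PlaneForest) → (F ∈ L) ⇔ (forestSize F ≡ n)) →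
      ((+ (n !) / 1 *ℚ sumℚ (map (λ F → prodℚ (map inv (forestHooks F))) L)
          ≡ + oddDoubleFact n / 1)
      × (sumℚ (map (λ F → prodℚ (map (λ h → (+ 2 / 1) -ℚ inv h) (forestHooks F))) L)
          ≡ divFact (+ ((2 * n + 1) ^ (n ∸ 1))) n)))
corollary4p5 n = (forests n , forests-unique n , ∈-forests n) , λ L L! L∈ →
  let L↭forests = ↭-forests n L! L∈ in
  trans (cong (+ (n !) / 1 *ℚ_) (total-↭ inv L↭forests)) (n!*hookSum-inv≡oddDoubleFact n) ,
  trans (total-↭ (λ h → (+ 2 / 1) -ℚ inv h) L↭forests) (hookSum-2-inv≡divFact n)
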